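{- For any positive integer $k$ and any nonempty finite subset $F$ of $k\mathbb{Z}$, the set $k\mathbb{Z}\setminus F$ is not a minimal complement in $\mathbb{Z}$.
   Context: For subsets $A,B$ of $\mathbb{Z}$, $A+B=\{a+b\}$. $A$ is a minimal complement to $B$ if $A+B=\mathbb{Z}$ and no proper subset $A'$ of $A$ satisfies $A'+B=\mathbb{Z}$. A subset of $\mathbb{Z}$ is a minimal complement in $\mathbb{Z}$ if it is a minimal complement to some nonempty subset of $\mathbb{Z}$. -}

module Defs where

open import Data.Integer using (ℤ; _+_; _*_; +_)
open import Data.Integer.Divisibility using (_∣_)
open import Data.Nat using (ℕ)
open import Data.List using (List)
open import Data.List.Membership.Propositional using (_∈_)
open import Data.Product using (Σ; ∃; _×_; _,_)
open import Relation.Binary.PropositionalEquality using (_≡_)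
open import Relation.Nullary using (¬_)

Subset : Set₁
Subset = ℤ → Set

_⊆_ : Subset → Subset → Set
A ⊆ B = ∀ x → A x → B x

_⊂_ : Subset → Subset → Set
A' ⊂ A = (A' ⊆ A) × (∃ λ a → A a × ¬ A' a)

Nonempty : Subset → Set
Nonempty B = ∃ λ b → B b

SumsToℤ : Subset → Subset → Set
SumsToℤ A B = ∀ (n : ℤ) → ∃ λ a → ∃ λ b → A a × B b × (a + b ≡ n)

IsMinimalComplementTo : Subset → Subset → Set₁
IsMinimalComplementTo A B =
  SumsToℤ A B × (∀ (A' : Subset) → A' ⊂ A → ¬ SumsToℤ A' B)

IsMinimalComplement : Subset → Set₁
IsMinimalComplement A = ∃ λ (B : Subset) → Nonempty B × IsMinimalComplementTo A B

kℤ∖ : ℕ → List ℤ → Subset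
kℤ∖ k F x = ((+ k) ∣ x) × ¬ (x ∈ F)

module Submission where

-- We exhibit an element a of A such that
-- A ∖ {a} + B = ℤ still holds, so A is not a minimal complement to B.
--
-- First, B meets every residue class mod k, and finitely many elements of B
-- (one per residue, the list reps) already do.  Fix f ∈ F.  For β ∈ reps,
-- write f + β = α' + β' with α' ∈ A; the shift α' - f is a NONZERO multiple
-- of k (as α' ∉ F).  Now take a ∈ kℤ outside a finite list of "dangerous"
-- integers: F itself, the A-parts of cov (g + β), and g - shift β, for g ∈ F
-- and β ∈ reps.  To cover n, take β ∈ reps with k ∣ n - β and x = n - β:
--   * x ∈ F:            cov n = cov (x + β) has A-part ≠ a by choice of a;
--   * x ∉ F and x ≠ a:  n = x + β;
--   * x = a:            n = (a + shift β) + β', and a + shift β ∈ A ∖ {a}.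

open import Defs
open import Data.Nat using (ℕ; NonZero)
open import Data.Integer using (ℤ; +_)
open import Data.Integer.Divisibility using (_∣_)
open import Data.List using (List; [])
open import Data.List.Membership.Propositional using (_∈_)
open import Relation.Binary.PropositionalEquality using (_≢_)
open import Relation.Nullary using (¬_)

import Data.Nat as N
import Data.Nat.Divisibility as ND
import Data.Nat.Properties as NP
open import Data.Integer using (_+_; _*_; _-_; ∣_∣; 0ℤ; _≟_)
import Data.Integer.Properties as ZP
import Data.Integer.Divisibility.Signed as Signed
open import Data.Integer.DivMod using (_%ℕ_; _/ℕ_; n%ℕd<d; a≡a%ℕn+[a/ℕn]*n)
open import Data.Integer.Tactic.RingSolver using (solve-∀)
open import Data.List using (_∷_; _++_; map; concatMap; upTo)
open import Data.List.Membership.Propositional using (_∉_)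
open import Data.List.Membership.Propositional.Properties
  using (∈-map⁺; ∈-map⁻; ∈-++⁺ˡ; ∈-++⁺ʳ; ∈-concatMap⁺; ∈-upTo⁺)
open import Data.List.Membership.DecPropositional _≟_ using (_∈?_)
open import Data.List.Relation.Unary.Any using (here; there)
import Data.List.Relation.Unary.Any as Any
open import Data.Nat.ListAction using (sum)
open import Data.Product using (∃; _×_; _,_; proj₁; proj₂)
open import Relation.Nullary using (yes; no)
open import Relation.Binary.PropositionalEquality
  using (_≡_; refl; sym; trans; cong; subst; module ≡-Reasoning)

∣-+ : ∀ {k m n} → k ∣ m → k ∣ n → k ∣ m + n
∣-+ {k} {m} {n} k∣m k∣n =
  Signed.∣⇒∣ᵤ (Signed.∣m∣n⇒∣m+n (Signed.∣ᵤ⇒∣ {k} {m} k∣m) (Signed.∣ᵤ⇒∣ {k} {n} k∣n))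

∣-- : ∀ {k m n} → k ∣ m → k ∣ n → k ∣ m - n
∣-- {k} {m} {n} k∣m k∣n =
  Signed.∣⇒∣ᵤ (Signed.∣m∣n⇒∣m-n (Signed.∣ᵤ⇒∣ {k} {m} k∣m) (Signed.∣ᵤ⇒∣ {k} {n} k∣n))

∣-*ʳ : ∀ k q → + k ∣ q * + k
∣-*ʳ k q = Signed.∣⇒∣ᵤ (Signed.∣n⇒∣m*n q (Signed.∣-refl {+ k}))

sub-add-cancel : ∀ (n b : ℤ) → (n - b) + b ≡ n
sub-add-cancel = solve-∀

add-sub-cancelʳ : ∀ (a s : ℤ) → (a + s) - s ≡ a
add-sub-cancelʳ = solve-∀

add-sub-cancelˡ : ∀ (a s : ℤ) → s ≡ (a + s) - a
add-sub-cancelˡ = solve-∀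

∣∣≤sum : ∀ {x xs} → x ∈ xs → ∣ x ∣ N.≤ sum (map ∣_∣ xs)
∣∣≤sum {xs = y ∷ ys} (here refl) = NP.m≤m+n ∣ y ∣ _
∣∣≤sum {xs = y ∷ ys} (there x∈ys) = NP.≤-trans (∣∣≤sum x∈ys) (NP.m≤n+m _ ∣ y ∣)

-- Every finite set of integers misses some multiple of k: k(1 + Σ|x|) is too large.
multipleOutside : (k : ℕ) .{{_ : NonZero k}} (L : List ℤ) → ∃ λ a → (+ k ∣ a) × a ∉ L
multipleOutside k L = a , ND.m∣m*n (N.suc S) , a∉L
  where
  S = sum (map ∣_∣ L)
  a = + (k N.* N.suc S)
  a∉L : a ∉ L
  a∉L a∈L = NP.<⇒≱ (NP.m≤n*m (N.suc S) k) (∣∣≤sum a∈L)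

_without_ : Subset → ℤ → Subset
(A without a) x = A x × x ≢ a

redundant⇒notMinimal : (A B : Subset) (a : ℤ) → A a → SumsToℤ (A without a) B →
  ¬ IsMinimalComplementTo A B
redundant⇒notMinimal A B a Aa cover (_ , minimal) =
  minimal (A without a) ((λ _ → proj₁) , a , Aa , λ Aa' → proj₂ Aa' refl) cover

module Parts {A B : Subset} (cov : SumsToℤ A B) where

  part₁ part₂ : ℤ → ℤ
  part₁ n = proj₁ (cov n)
  part₂ n = proj₁ (proj₂ (cov n))

  part₁∈A : ∀ n → A (part₁ n)
  part₁∈A n = proj₁ (proj₂ (proj₂ (cov n)))

  part₂∈B : ∀ n → B (part₂ n)
  part₂∈B n = proj₁ (proj₂ (proj₂ (proj₂ (cov n))))

  parts-sum : ∀ n → part₁ n + part₂ n ≡ n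
  parts-sum n = proj₂ (proj₂ (proj₂ (proj₂ (cov n))))

ResidueRepresentatives : ℕ → Subset → Set
ResidueRepresentatives k B =
  ∃ λ (reps : List ℤ) → (∀ β → β ∈ reps → B β) ×
                        (∀ n → ∃ λ β → β ∈ reps × + k ∣ n - β)

-- If A ⊆ kℤ and A + B = ℤ, then B has residue representatives mod k: the
-- B-parts of the representations of 0, 1, …, k - 1.
residueRepresentatives : (k : ℕ) .{{_ : NonZero k}} (A B : Subset) →
  (∀ x → A x → + k ∣ x) → SumsToℤ A B → ResidueRepresentatives k B
residueRepresentatives k A B A⊆kℤ cov = reps , reps⊆B , represent
  where
  open Parts cov

  rep : ℕ → ℤ
  rep r = part₂ (+ r)

  reps : List ℤ
  reps = map rep (upTo k)

  reps⊆B : ∀ β → β ∈ reps → B β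
  reps⊆B β β∈reps with ∈-map⁻ rep β∈reps
  ... | r , _ , refl = part₂∈B (+ r)

  residue-eq : ∀ (x y q m : ℤ) → ((x + y) + q * m) - y ≡ x + q * m
  residue-eq = solve-∀

  represent : ∀ n → ∃ λ β → β ∈ reps × + k ∣ n - β
  represent n = rep r , ∈-map⁺ rep (∈-upTo⁺ (n%ℕd<d n k)) , k∣n-β
    where
    open ≡-Reasoning
    r = n %ℕ k
    q = n /ℕ k
    α = part₁ (+ r)
    n-β≡ : n - rep r ≡ α + q * + k
    n-β≡ = begin
      n - rep r                       ≡⟨ cong (_- rep r) (a≡a%ℕn+[a/ℕn]*n n k) ⟩
      (+ r + q * + k) - rep r         ≡⟨ cong (λ t → (t + q * + k) - rep r) (sym (parts-sum (+ r))) ⟩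
      ((α + rep r) + q * + k) - rep r ≡⟨ residue-eq α (rep r) q (+ k) ⟩
      α + q * + k                     ∎
    k∣n-β : + k ∣ n - rep r
    k∣n-β = subst (+ k ∣_) (sym n-β≡)
              (∣-+ {+ k} {α} {q * + k} (A⊆kℤ α (part₁∈A (+ r))) (∣-*ʳ k q))

module Removal (k : ℕ) .{{_ : NonZero k}} (F : List ℤ) (f : ℤ) (f∈F : f ∈ F)
  (F⊆kℤ : ∀ x → x ∈ F → + k ∣ x) (B : Subset) (cov : SumsToℤ (kℤ∖ k F) B) where

  A : Subset
  A = kℤ∖ k F

  open Parts cov

  representatives : ResidueRepresentatives k B
  representatives = residueRepresentatives k A B (λ _ → proj₁) cov

  reps : List ℤ
  reps = proj₁ representatives

  reps⊆B : ∀ β → β ∈ reps → B β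
  reps⊆B = proj₁ (proj₂ representatives)

  represent : ∀ n → ∃ λ β → β ∈ reps × + k ∣ n - β
  represent = proj₂ (proj₂ representatives)

  -- Rewriting f + β = α' + β' moves n - β to n - β' by shift β = α' - f.
  shift : ℤ → ℤ
  shift β = part₁ (f + β) - f

  shift≢0 : ∀ β → shift β ≢ 0ℤ
  shift≢0 β shift≡0 =
    proj₂ (part₁∈A (f + β)) (subst (_∈ F) (sym (ZP.i-j≡0⇒i≡j _ _ shift≡0)) f∈F)

  k∣shift : ∀ β → + k ∣ shift β
  k∣shift β = ∣-- {+ k} {part₁ (f + β)} {f} (proj₁ (part₁∈A (f + β))) (F⊆kℤ f f∈F)

  detour-eq : ∀ n β → n - part₂ (f + β) ≡ (n - β) + shift β
  detour-eq n β = begin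
    n - β'                                         ≡⟨ expand n β α' β' f ⟩
    ((n - β) + (α' - f)) + ((f + β) - (α' + β'))   ≡⟨ cong (λ t → ((n - β) + (α' - f)) + (t - (α' + β'))) (sym (parts-sum (f + β))) ⟩
    ((n - β) + (α' - f)) + ((α' + β') - (α' + β')) ≡⟨ cancel ((n - β) + (α' - f)) (α' + β') ⟩
    (n - β) + (α' - f)                             ∎
    where
    open ≡-Reasoning
    α' = part₁ (f + β)
    β' = part₂ (f + β)
    expand : ∀ (x y u v w : ℤ) → x - v ≡ ((x - y) + (u - w)) + ((w + y) - (u + v))
    expand = solve-∀
    cancel : ∀ (x y : ℤ) → x + (y - y) ≡ x
    cancel = solve-∀

  -- The integers a must avoid for the representative β: the A-parts of the
  -- chosen representations of F + β, and F - shift β (so that a + shift β ∉ F).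
  dangerous : ℤ → List ℤ
  dangerous β = map (λ g → part₁ (g + β)) F ++ map (_- shift β) F

  avoided : List ℤ
  avoided = F ++ concatMap dangerous reps

  a : ℤ
  a = proj₁ (multipleOutside k avoided)

  k∣a : + k ∣ a
  k∣a = proj₁ (proj₂ (multipleOutside k avoided))

  a-avoids : a ∉ avoided
  a-avoids = proj₂ (proj₂ (multipleOutside k avoided))

  a∈A : A a
  a∈A = k∣a , λ a∈F → a-avoids (∈-++⁺ˡ a∈F)

  avoidsDangerous : ∀ {β x} → β ∈ reps → x ∈ dangerous β → x ≢ a
  avoidsDangerous β∈reps x∈ refl =
    a-avoids (∈-++⁺ʳ F (∈-concatMap⁺ dangerous (Any.map (λ { refl → x∈ }) β∈reps)))

  part₁≢a : ∀ {β g} n → β ∈ reps → g ∈ F → n ≡ g + β → part₁ n ≢ a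
  part₁≢a {β} _ β∈reps g∈F refl =
    avoidsDangerous β∈reps (∈-++⁺ˡ (∈-map⁺ (λ g → part₁ (g + β)) g∈F))

  a+shift∉F : ∀ {β} → β ∈ reps → a + shift β ∉ F
  a+shift∉F {β} β∈reps a+shift∈F =
    avoidsDangerous β∈reps (∈-++⁺ʳ _ (∈-map⁺ (_- shift β) a+shift∈F))
                    (add-sub-cancelʳ a (shift β))

  a+shift≢a : ∀ β → a + shift β ≢ a
  a+shift≢a β eq = shift≢0 β (trans (add-sub-cancelˡ a (shift β)) (ZP.i≡j⇒i-j≡0 eq))

  cover : SumsToℤ (A without a) B
  cover n with represent n
  ... | β , β∈reps , k∣x with n - β ∈? F | n - β ≟ a
  ... | yes x∈F | _ = part₁ n , part₂ n
    , (part₁∈A n , part₁≢a n β∈reps x∈F (sym (sub-add-cancel n β)))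
    , part₂∈B n , parts-sum n
  ... | no x∉F | no x≢a = n - β , β
    , ((k∣x , x∉F) , x≢a) , reps⊆B β β∈reps , sub-add-cancel n β
  ... | no _ | yes x≡a = a + shift β , β'
    , ((∣-+ {+ k} {a} {shift β} k∣a (k∣shift β) , a+shift∉F β∈reps) , a+shift≢a β)
    , part₂∈B (f + β) , sums-to-n
    where
    open ≡-Reasoning
    β' = part₂ (f + β)
    sums-to-n : (a + shift β) + β' ≡ n
    sums-to-n = begin
      (a + shift β) + β'       ≡⟨ cong (λ t → (t + shift β) + β') (sym x≡a) ⟩
      ((n - β) + shift β) + β' ≡⟨ cong (_+ β') (sym (detour-eq n β)) ⟩
      (n - β') + β'            ≡⟨ sub-add-cancel n β' ⟩
      n                        ∎

corollary2p22 : (k : ℕ) → NonZero k → (F : List ℤ) → F ≢ [] →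
    (∀ x → x ∈ F → (+ k) ∣ x) → ¬ IsMinimalComplement (kℤ∖ k F)
corollary2p22 k nz [] F≢[] _ _ = F≢[] refl
corollary2p22 k nz (f ∷ F) _ F⊆kℤ (B , _ , minimalComplement) =
  redundant⇒notMinimal (kℤ∖ k (f ∷ F)) B a a∈A cover minimalComplement
  where open Removal k {{nz}} (f ∷ F) f (here refl) F⊆kℤ B (proj₁ minimalComplement)
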